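{- Let $q$ be a prime power, $n\ge2$, and $0<k<n$. Let $\mathcal U_{k,n}(q)$ be the uniform $q$-matroid of rank $k$ on $\mathbb F_q^n$. Then there is no positive integer $m<n$ such that $\mathcal U_{k,n}(q)$ is $\mathbb F_q^{n\times m}$-representable.
   Context: Let $E=\mathbb F_q^n$ and $\mathcal L(E)$ the set of its $\mathbb F_q$-subspaces. $\mathcal U_{k,n}(q)=(\mathcal L(E),\rho)$ with $\rho(V)=\min\{k,\dim V\}$. For an $\mathbb F_q$-linear subspace $\mathcal C\subseteq\mathbb F_q^{n\times m}$ of dimension $k'$, set $\mathcal C(W)=\{M\in\mathcal C:\operatorname{colsp}_{\mathbb F_q}(M)\subseteq W\}$ and $\rho_{\mathcal C}(U)=(k'-\dim\mathcal C(U^\perp))/m$, with $U^\perp$ the orthogonal complement under the standard dot product. A $q$-matroid $(\mathcal L(E),\rho)$ is $\mathbb F_q^{n\times m}$-representable if $\rho=\rho_{\mathcal C}$ for some such $\mathcal C$. -}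

module Defs where

open import Level using (0ℓ)
open import Data.Nat using (ℕ; zero; suc; _<_) renaming (_^_ to _^ℕ_)
open import Data.Nat.Primality using (Prime)
open import Data.Fin using (Fin)
import Data.Fin as Fin
open import Data.Product using (Σ; ∃; _×_; _,_)
open import Relation.Nullary using (¬_)
open import Relation.Binary.PropositionalEquality using (_≡_)
import Relation.Binary.PropositionalEquality as ≡
open import Algebra.Bundles using (CommutativeRing)
open import Function.Bundles using (Inverse)
import Data.Nat as ℕ

PrimePower : ℕ → Set
PrimePower q = Σ ℕ λ p → Σ ℕ λ e → Prime p × (0 < e) × (q ≡ p ^ℕ e)

record Field : Set₁ where
  field
    commRing : CommutativeRing 0ℓ 0ℓ
  open CommutativeRing commRing public
  field
    1≉0     : ¬ (1# ≈ 0#)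
    inverse : ∀ x → ¬ (x ≈ 0#) → Σ Carrier λ y → (x * y) ≈ 1#

HasCard : Field → ℕ → Set
HasCard F q = Inverse (≡.setoid (Fin q)) (Field.setoid F)

module LinAlg (F : Field) where
  open Field F

  -- vectors indexed by a type I (F^n uses I = Fin n; matrices F^{n×m} use I = Fin n × Fin m)
  Vect : Set → Set
  Vect I = I → Carrier

  _≈v_ : ∀ {I} → Vect I → Vect I → Set
  u ≈v v = ∀ i → u i ≈ v i

  0v : ∀ {I} → Vect I
  0v _ = 0#

  _+v_ : ∀ {I} → Vect I → Vect I → Vect I
  (u +v v) i = u i + v i

  _·v_ : ∀ {I} → Carrier → Vect I → Vect I
  (a ·v v) i = a * v i

  record Subspace (I : Set) : Set₁ where
    field
      _∈S_    : Vect I → Set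
      resp    : ∀ {u v} → u ≈v v → _∈S_ u → _∈S_ v
      zero∈   : _∈S_ 0v
      +-closed : ∀ {u v} → _∈S_ u → _∈S_ v → _∈S_ (u +v v)
      ·-closed : ∀ a {v} → _∈S_ v → _∈S_ (a ·v v)
  open Subspace public

  sumF : ∀ d → (Fin d → Carrier) → Carrier
  sumF zero    f = 0#
  sumF (suc d) f = f Fin.zero + sumF d (λ i → f (Fin.suc i))

  lincomb : ∀ {I} d → (Fin d → Vect I) → (Fin d → Carrier) → Vect I
  lincomb d vs c i = sumF d (λ j → c j * vs j i)

  LinIndep : ∀ {I} d → (Fin d → Vect I) → Set
  LinIndep d vs = ∀ c → lincomb d vs c ≈v 0v → ∀ j → c j ≈ 0#

  IsBasis : ∀ {I} → Subspace I → ∀ d → (Fin d → Vect I) → Set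
  IsBasis V d vs =
    (∀ j → (V ∈S vs j)) × LinIndep d vs ×
    (∀ v → V ∈S v → Σ (Fin d → Carrier) λ c → lincomb d vs c ≈v v)

  HasDim : ∀ {I} → Subspace I → ℕ → Set
  HasDim V d = Σ (Fin d → Vect _) λ vs → IsBasis V d vs

  dot : ∀ {n} → Vect (Fin n) → Vect (Fin n) → Carrier
  dot {n} u v = sumF n (λ i → u i * v i)

  _⊥ : ∀ {n} → Subspace (Fin n) → Subspace (Fin n)
  _⊥ {n} U = record
    { _∈S_ = λ v → ∀ u → U ∈S u → dot u v ≈ 0#
    ; resp = λ {x} {y} x≈y h u uU → trans (sym (dotResp u x≈y)) (h u uU)
    ; zero∈ = λ u _ → sumZ n u
    ; +-closed = λ {x} {y} hx hy u uU →
        trans (dot+ n u x y) (trans (+-cong (hx u uU) (hy u uU)) (+-identityˡ 0#))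
    ; ·-closed = λ a {x} hx u uU → trans (dot· n u a x) (trans (*-congˡ (hx u uU)) (zeroʳ a))
    }
    where
    sumCong : ∀ d {f g : Fin d → Carrier} → (∀ i → f i ≈ g i) → sumF d f ≈ sumF d g
    sumCong zero    e = refl
    sumCong (suc d) e = +-cong (e Fin.zero) (sumCong d (λ i → e (Fin.suc i)))
    dotResp : ∀ {d} (u : Vect (Fin d)) {x y : Vect (Fin d)} → x ≈v y → dot u x ≈ dot u y
    dotResp {d} u e = sumCong d (λ i → *-congˡ (e i))
    sumZ : ∀ d (u : Vect (Fin d)) → sumF d (λ i → u i * 0#) ≈ 0#
    sumZ zero    u = refl
    sumZ (suc d) u = trans (+-cong (zeroʳ (u Fin.zero)) (sumZ d (λ i → u (Fin.suc i)))) (+-identityˡ 0#)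
    dot+ : ∀ d (u x y : Vect (Fin d)) →
           sumF d (λ i → u i * (x i + y i)) ≈ sumF d (λ i → u i * x i) + sumF d (λ i → u i * y i)
    dot+ zero    u x y = sym (+-identityˡ 0#)
    dot+ (suc d) u x y =
      trans (+-cong (distribˡ (u Fin.zero) (x Fin.zero) (y Fin.zero))
                    (dot+ d (λ i → u (Fin.suc i)) (λ i → x (Fin.suc i)) (λ i → y (Fin.suc i))))
            (swap4 _ _ _ _)
      where
      swap4 : ∀ a b c e → (a + b) + (c + e) ≈ (a + c) + (b + e)
      swap4 a b c e =
        trans (+-assoc a b (c + e))
        (trans (+-congˡ (trans (sym (+-assoc b c e)) (trans (+-congʳ (+-comm b c)) (+-assoc c b e))))
        (sym (+-assoc a c (b + e))))
    dot· : ∀ d (u : Vect (Fin d)) a (x : Vect (Fin d)) →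
           sumF d (λ i → u i * (a * x i)) ≈ a * sumF d (λ i → u i * x i)
    dot· zero    u a x = sym (zeroʳ a)
    dot· (suc d) u a x =
      trans (+-cong (lem (u Fin.zero) (x Fin.zero)) (dot· d (λ i → u (Fin.suc i)) a (λ i → x (Fin.suc i))))
            (sym (distribˡ a _ _))
      where
      lem : ∀ b y → b * (a * y) ≈ a * (b * y)
      lem b y = trans (sym (*-assoc b a y)) (trans (*-congʳ (*-comm b a)) (*-assoc a b y))

  Mat : ℕ → ℕ → Set
  Mat n m = Vect (Fin n × Fin m)

  ColspIn : ∀ {n m} → Mat n m → Subspace (Fin n) → Set
  ColspIn {n} {m} M W = ∀ (j : Fin m) → W ∈S (λ i → M (i , j))

  restrict : ∀ {n m} → Subspace (Fin n × Fin m) → Subspace (Fin n) → Subspace (Fin n × Fin m)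
  restrict C W = record
    { _∈S_ = λ M → (C ∈S M) × ColspIn M W
    ; resp = λ e (c , w) → resp C e c , λ j → resp W (λ i → e (i , j)) (w j)
    ; zero∈ = zero∈ C , λ j → zero∈ W
    ; +-closed = λ (c , w) (c' , w') → +-closed C c c' , λ j → +-closed W (w j) (w' j)
    ; ·-closed = λ a (c , w) → ·-closed C a c , λ j → ·-closed W a (w j)
    }

  -- ρ_C = ρ_{U_{k,n}}, i.e. for every subspace U of F^n with dim U = d and dim C(U^⊥) = e:
  --   (k' - e)/m = min{k, d},   equivalently   m · min{k,d} + e = k'
  RepresentsUniform : ∀ (k n m : ℕ) → Subspace (Fin n × Fin m) → ℕ → Set₁
  RepresentsUniform k n m C k' =
    ∀ (U : Subspace (Fin n)) (d e : ℕ) → HasDim U d → HasDim (restrict C (U ⊥)) e →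
      (m ℕ.* ℕ._⊓_ k d) ℕ.+ e ≡ k'

  UniformRepresentable : ℕ → ℕ → ℕ → Set₁
  UniformRepresentable k n m =
    Σ (Subspace (Fin n × Fin m)) λ C → Σ ℕ λ k' → HasDim C k' × RepresentsUniform k n m C k'

{-# OPTIONS --safe #-}
-- Taking U = F^n shows dim C = mk, and then dim C(U^⊥) = 0 whenever dim U ≥ k: no nonzero
-- matrix of C has its columns in a subspace of dimension ≤ n - k.  The proof of the rank-metric
-- Singleton bound then applies.  With t = min(m, n - k) and s = m - t, vanishing on the last s
-- columns is ns linear conditions on C, so if ns < mk some nonzero M ∈ C satisfies them; but
-- then all columns of M lie in the span of its first t columns, a contradiction.  Hence
-- mk ≤ ns, which is false when 0 < k < n and 0 < m < n.
module Submission where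

open import Defs
open import Data.Nat using (ℕ; _<_; _≤_)
open import Data.Product using (_×_)
open import Relation.Nullary using (¬_)

open import Data.Nat using (zero; suc; z≤n; s≤s)
import Data.Nat as ℕ
import Data.Nat.Properties as ℕₚ
open import Data.Fin using (Fin; zero; suc; _↑ˡ_; _↑ʳ_; splitAt; punchIn; punchOut; remQuot; combine)
import Data.Fin as Fin
open import Data.Fin.Properties
  using (all?; ¬∀⟶∃¬; punchIn-punchOut; remQuot-combine; splitAt⁻¹-↑ˡ; splitAt⁻¹-↑ʳ)
open import Data.Vec.Functional using (_∷_; head; tail)
open import Data.Product using (Σ; _,_; proj₁; proj₂; uncurry)
open import Data.Sum using (inj₁; inj₂)
open import Function using (_∘_; Inverse)
open import Relation.Nullary using (yes; no; contradiction)
import Relation.Nullary.Decidable as Dec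
open import Relation.Binary.Definitions using (Decidable)
open import Relation.Binary.PropositionalEquality using (_≡_)
import Relation.Binary.PropositionalEquality as ≡

module _ (F : Field) where
  open Field F hiding (zero)
  open LinAlg F
  open import Relation.Binary.Reasoning.Setoid setoid
  open import Algebra.Properties.Semiring.Sum semiring
    using (sum; sum-cong-≋; sum-replicate-zero; ∑-distrib-+; *-distribˡ-sum)
  open import Algebra.Properties.Ring ring using (-‿distribʳ-*)
  open import Algebra.Properties.Group +-group using (∙-cancelʳ)
  open import Algebra.Properties.Monoid *-monoid using (cancelˡ; insertˡ)
  open import Algebra.Properties.CommutativeSemigroup *-commutativeSemigroup using (x∙yz≈y∙xz)

  sumF≡sum : ∀ d (f : Fin d → Carrier) → sumF d f ≡ sum f
  sumF≡sum zero    f = ≡.refl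
  sumF≡sum (suc d) f = ≡.cong (f zero +_) (sumF≡sum d (tail f))

  sumF-cong : ∀ d {f g : Fin d → Carrier} → (∀ i → f i ≈ g i) → sumF d f ≈ sumF d g
  sumF-cong d {f} {g} f≈g rewrite sumF≡sum d f | sumF≡sum d g = sum-cong-≋ f≈g

  sumF-zero : ∀ d {f : Fin d → Carrier} → (∀ i → f i ≈ 0#) → sumF d f ≈ 0#
  sumF-zero d {f} f≈0 rewrite sumF≡sum d f = trans (sum-cong-≋ f≈0) (sum-replicate-zero d)

  sumF-+ : ∀ d (f g : Fin d → Carrier) → sumF d (λ i → f i + g i) ≈ sumF d f + sumF d g
  sumF-+ d f g rewrite sumF≡sum d (λ i → f i + g i) | sumF≡sum d f | sumF≡sum d g = ∑-distrib-+ f g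

  *-distribˡ-sumF : ∀ d x (f : Fin d → Carrier) → x * sumF d f ≈ sumF d (λ i → x * f i)
  *-distribˡ-sumF d x f rewrite sumF≡sum d f | sumF≡sum d (λ i → x * f i) = *-distribˡ-sum x f

  dot-congʳ : ∀ {n} (u : Vect (Fin n)) {v w} → v ≈v w → dot u v ≈ dot u w
  dot-congʳ {n} u v≈w = sumF-cong n (λ i → *-congˡ (v≈w i))

  dot-comm : ∀ {n} (u v : Vect (Fin n)) → dot u v ≈ dot v u
  dot-comm {n} u v = sumF-cong n (λ i → *-comm (u i) (v i))

  dot-congˡ : ∀ {n} {u v : Vect (Fin n)} w → u ≈v v → dot u w ≈ dot v w
  dot-congˡ {u = u} {v} w u≈v = trans (dot-comm u w) (trans (dot-congʳ w u≈v) (dot-comm w v))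

  dot-zeroʳ : ∀ {n} (u : Vect (Fin n)) → dot u 0v ≈ 0#
  dot-zeroʳ {n} u = sumF-zero n (λ i → zeroʳ (u i))

  dot-zeroˡ : ∀ {n} (v : Vect (Fin n)) → dot 0v v ≈ 0#
  dot-zeroˡ v = trans (dot-comm 0v v) (dot-zeroʳ v)

  dot-+ʳ : ∀ {n} (u v w : Vect (Fin n)) → dot u (v +v w) ≈ dot u v + dot u w
  dot-+ʳ {n} u v w = trans (sumF-cong n (λ i → distribˡ (u i) (v i) (w i))) (sumF-+ n _ _)

  dot-+ˡ : ∀ {n} (u v w : Vect (Fin n)) → dot (u +v v) w ≈ dot u w + dot v w
  dot-+ˡ u v w = begin
    dot (u +v v) w      ≈⟨ dot-comm (u +v v) w ⟩
    dot w (u +v v)      ≈⟨ dot-+ʳ w u v ⟩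
    dot w u + dot w v   ≈⟨ +-cong (dot-comm w u) (dot-comm w v) ⟩
    dot u w + dot v w   ∎

  dot-·ʳ : ∀ {n} (u : Vect (Fin n)) a v → dot u (a ·v v) ≈ a * dot u v
  dot-·ʳ {n} u a v = trans (sumF-cong n (λ i → x∙yz≈y∙xz (u i) a (v i))) (sym (*-distribˡ-sumF n a _))

  dot-·ˡ : ∀ {n} a (u v : Vect (Fin n)) → dot (a ·v u) v ≈ a * dot u v
  dot-·ˡ a u v = trans (dot-comm (a ·v u) v) (trans (dot-·ʳ v a u) (*-congˡ (dot-comm v u)))

  dot-lincombʳ : ∀ {n} (u : Vect (Fin n)) d (vs : Fin d → Vect (Fin n)) c →
                 dot u (lincomb d vs c) ≈ dot c (λ j → dot u (vs j))
  dot-lincombʳ u zero    vs c = dot-zeroʳ u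
  dot-lincombʳ u (suc d) vs c = begin
    dot u ((c zero ·v vs zero) +v lincomb d (tail vs) (tail c))
      ≈⟨ dot-+ʳ u _ _ ⟩
    dot u (c zero ·v vs zero) + dot u (lincomb d (tail vs) (tail c))
      ≈⟨ +-cong (dot-·ʳ u (c zero) (vs zero)) (dot-lincombʳ u d (tail vs) (tail c)) ⟩
    c zero * dot u (vs zero) + dot (tail c) (λ j → dot u (vs (suc j)))
      ∎

  lincomb-orthogonal : ∀ {n} {u : Vect (Fin n)} d (vs : Fin d → Vect (Fin n)) c →
                       (∀ j → dot u (vs j) ≈ 0#) → dot u (lincomb d vs c) ≈ 0#
  lincomb-orthogonal {u = u} d vs c u⊥vs =
    trans (dot-lincombʳ u d vs c) (trans (dot-congʳ c u⊥vs) (dot-zeroʳ c))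

  unit : ∀ {n} → Fin n → Vect (Fin n)
  unit zero    = 1# ∷ 0v
  unit (suc i) = 0# ∷ unit i

  dot-unitˡ : ∀ {n} (i : Fin n) v → dot (unit i) v ≈ v i
  dot-unitˡ {suc n} zero v =
    trans (+-cong (*-identityˡ (v zero)) (sumF-zero n (λ i → zeroˡ (v (suc i))))) (+-identityʳ (v zero))
  dot-unitˡ (suc i) v = trans (+-cong (zeroˡ (v zero)) (dot-unitˡ i (tail v))) (+-identityˡ (v (suc i)))

  lincomb∈ : ∀ {I} (S : Subspace I) d {vs : Fin d → Vect I} c → (∀ j → S ∈S vs j) → S ∈S lincomb d vs c
  lincomb∈ S zero    c vs∈S = zero∈ S
  lincomb∈ S (suc d) c vs∈S =
    +-closed S (·-closed S (c zero) (vs∈S zero)) (lincomb∈ S d (tail c) (vs∈S ∘ suc))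

  record IsLinear {I J : Set} (T : Vect I → Vect J) : Set where
    field
      cong  : ∀ {u v} → u ≈v v → T u ≈v T v
      +-hom : ∀ u v → T (u +v v) ≈v (T u +v T v)
      ·-hom : ∀ a v → T (a ·v v) ≈v (a ·v T v)

    0-hom : T 0v ≈v 0v
    0-hom j = trans (cong (λ _ → sym (zeroˡ 0#)) j) (trans (·-hom 0# 0v j) (zeroˡ _))

    lincomb-hom : ∀ d (ws : Fin d → Vect I) c → T (lincomb d ws c) ≈v lincomb d (T ∘ ws) c
    lincomb-hom zero    ws c = 0-hom
    lincomb-hom (suc d) ws c j =
      trans (+-hom _ _ j) (+-cong (·-hom (c zero) (ws zero) j) (lincomb-hom d (tail ws) (tail c) j))

  lincomb-isLinear : ∀ {I} d (vs : Fin d → Vect I) → IsLinear (lincomb d vs)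
  lincomb-isLinear d vs = record
    { cong  = λ c≈c' i → sumF-cong d (λ j → *-congʳ (c≈c' j))
    ; +-hom = λ c c' i → trans (sumF-cong d (λ j → distribʳ (vs j i) (c j) (c' j))) (sumF-+ d _ _)
    ; ·-hom = λ a c i →
        trans (sumF-cong d (λ j → *-assoc a (c j) (vs j i))) (sym (*-distribˡ-sumF d a _))
    }

  HasDim-image : ∀ {I J} {S : Subspace I} {S' : Subspace J} {T : Vect I → Vect J} → IsLinear T →
                 (∀ v → T v ≈v 0v → v ≈v 0v) →
                 (∀ {v} → S ∈S v → S' ∈S T v) →
                 (∀ {w} → S' ∈S w → Σ (Vect I) λ v → S ∈S v × T v ≈v w) →
                 ∀ {d} → HasDim S d → HasDim S' d
  HasDim-image {S' = S'} {T = T} T-linear T-injective T-maps T-onto {d}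
               (ws , ws∈S , ws-indep , ws-span) =
    T ∘ ws , T-maps ∘ ws∈S , indep , span
    where
    open IsLinear T-linear
    indep : LinIndep d (T ∘ ws)
    indep c Tws·c≈0 = ws-indep c (T-injective _ (λ j → trans (lincomb-hom d ws c j) (Tws·c≈0 j)))
    span : ∀ w → S' ∈S w → Σ (Fin d → Carrier) λ c → lincomb d (T ∘ ws) c ≈v w
    span w w∈S' with T-onto w∈S'
    ... | v , v∈S , Tv≈w with ws-span v v∈S
    ...   | c , ws·c≈v = c , λ j → trans (sym (lincomb-hom d ws c j)) (trans (cong ws·c≈v j) (Tv≈w j))

  LinIndep⇒head≉0 : ∀ {I e} {vs : Fin (suc e) → Vect I} → LinIndep (suc e) vs → ¬ (vs zero ≈v 0v)
  LinIndep⇒head≉0 {e = e} {vs} indep vs₀≈0 = 1≉0 (indep (1# ∷ 0v) vs·1∷0≈0 zero)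
    where
    vs·1∷0≈0 : lincomb (suc e) vs (1# ∷ 0v) ≈v 0v
    vs·1∷0≈0 i =
      trans (+-cong (trans (*-identityˡ _) (vs₀≈0 i)) (sumF-zero e (λ j → zeroˡ _))) (+-identityˡ 0#)

  HasDim-0⇒≈0v : ∀ {I} (S : Subspace I) → HasDim S 0 → ∀ {v} → S ∈S v → v ≈v 0v
  HasDim-0⇒≈0v S (_ , _ , _ , span) {v} v∈S i = sym (proj₂ (span v v∈S) i)

  ≈0v⇒dim≡0 : ∀ {I} (S : Subspace I) → (∀ {v} → S ∈S v → v ≈v 0v) → ∀ {e} → HasDim S e → e ≡ 0
  ≈0v⇒dim≡0 S S≈0 {zero}  _                       = ≡.refl
  ≈0v⇒dim≡0 S S≈0 {suc e} (ws , ws∈S , indep , _) =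
    contradiction (S≈0 (ws∈S zero)) (LinIndep⇒head≉0 {vs = ws} indep)

  HasDim-free-head : ∀ {a} {S : Subspace (Fin a)} {S' : Subspace (Fin (suc a))} →
                     (∀ {v} → S ∈S tail v → S' ∈S v) → (∀ {v} → S' ∈S v → S ∈S tail v) →
                     ∀ {e} → HasDim S e → HasDim S' (suc e)
  HasDim-free-head {S = S} {S'} to from {e} (ws , ws∈S , ws-indep , ws-span) =
    basis , basis∈S' , indep , span
    where
    basis : Fin (suc e) → Vect (Fin (suc _))
    basis zero    = 1# ∷ 0v
    basis (suc j) = 0# ∷ ws j
    basis∈S' : ∀ j → S' ∈S basis j
    basis∈S' zero    = to (zero∈ S)
    basis∈S' (suc j) = to (ws∈S j)
    head-lincomb : ∀ c → lincomb (suc e) basis c zero ≈ c zero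
    head-lincomb c = trans (+-cong (*-identityʳ _) (sumF-zero e (λ j → zeroʳ _))) (+-identityʳ _)
    tail-lincomb : ∀ c i → lincomb (suc e) basis c (suc i) ≈ lincomb e ws (tail c) i
    tail-lincomb c i = trans (+-congʳ (zeroʳ _)) (+-identityˡ _)
    indep : LinIndep (suc e) basis
    indep c basis·c≈0 zero    = trans (sym (head-lincomb c)) (basis·c≈0 zero)
    indep c basis·c≈0 (suc j) =
      ws-indep (tail c) (λ i → trans (sym (tail-lincomb c i)) (basis·c≈0 (suc i))) j
    span : ∀ v → S' ∈S v → Σ (Fin (suc e) → Carrier) λ c → lincomb (suc e) basis c ≈v v
    span v v∈S' with ws-span (tail v) (from v∈S')
    ... | c , ws·c≈tail-v = head v ∷ c , λ where
      zero    → head-lincomb (head v ∷ c)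
      (suc i) → trans (tail-lincomb (head v ∷ c) i) (ws·c≈tail-v i)

  Solutions : ∀ {r a} → (Fin r → Vect (Fin a)) → Subspace (Fin a)
  Solutions rows = record
    { _∈S_     = λ v → ∀ x → dot (rows x) v ≈ 0#
    ; resp     = λ v≈w v∈ x → trans (sym (dot-congʳ (rows x) v≈w)) (v∈ x)
    ; zero∈    = λ x → dot-zeroʳ (rows x)
    ; +-closed = λ u∈ v∈ x → trans (dot-+ʳ (rows x) _ _) (trans (+-cong (u∈ x) (v∈ x)) (+-identityʳ 0#))
    ; ·-closed = λ a v∈ x → trans (dot-·ʳ (rows x) a _) (trans (*-congˡ (v∈ x)) (zeroʳ a))
    }

  Solutions⊆⊥ : ∀ {n d} {U : Subspace (Fin n)} {us : Fin d → Vect (Fin n)} → IsBasis U d us →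
                ∀ {v} → Solutions us ∈S v → (U ⊥) ∈S v
  Solutions⊆⊥ {d = d} {us = us} (_ , _ , us-span) {v} v∈ u u∈U with us-span u u∈U
  ... | c , us·c≈u = begin
    dot u v                 ≈⟨ dot-congˡ v (λ i → sym (us·c≈u i)) ⟩
    dot (lincomb d us c) v  ≈⟨ dot-comm _ v ⟩
    dot v (lincomb d us c)  ≈⟨ lincomb-orthogonal d us c (λ a → trans (dot-comm v (us a)) (v∈ a)) ⟩
    0#                      ∎

  lincomb∈Solutions⊥ : ∀ {n t} (rs : Fin t → Vect (Fin n)) c → (Solutions rs ⊥) ∈S lincomb t rs c
  lincomb∈Solutions⊥ {t = t} rs c u u∈ =
    lincomb-orthogonal t rs c (λ l → trans (dot-comm u (rs l)) (u∈ l))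

  flatten : ∀ {d m} {A : Set} → (Fin d → Fin m → A) → Fin (d ℕ.* m) → A
  flatten {m = m} f x = uncurry f (remQuot m x)

  Solutions-flatten⁻ : ∀ {d m a} (rows : Fin d → Fin m → Vect (Fin a)) {v} →
                       Solutions (flatten rows) ∈S v → ∀ i j → dot (rows i j) v ≈ 0#
  Solutions-flatten⁻ rows {v} v∈ i j =
    ≡.subst (λ ij → dot (uncurry rows ij) v ≈ 0#) (remQuot-combine i j) (v∈ (combine i j))

  Solutions-flatten⁺ : ∀ {d m a} (rows : Fin d → Fin m → Vect (Fin a)) {v} →
                       (∀ i j → dot (rows i j) v ≈ 0#) → Solutions (flatten rows) ∈S v
  Solutions-flatten⁺ {m = m} rows rows⊥v x = uncurry rows⊥v (remQuot m x)

  dot-head≈0 : ∀ {a} (r : Vect (Fin (suc a))) v → head r ≈ 0# → dot r v ≈ dot (tail r) (tail v)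
  dot-head≈0 r v r₀≈0 = trans (+-congʳ (trans (*-congʳ r₀≈0) (zeroˡ (head v)))) (+-identityˡ _)

  -- For a pivot row p with head p invertible, p · (x ∷ w) = 0 iff x = q · w; substituting this
  -- x turns the equation r · (x ∷ w) = 0 into reduce r · w = 0.
  module Pivot {a} (p : Vect (Fin (suc a))) {p₀⁻¹ : Carrier} (p₀p₀⁻¹≈1 : head p * p₀⁻¹ ≈ 1#) where
    q : Vect (Fin a)
    q i = - (p₀⁻¹ * p (suc i))

    extend : Vect (Fin a) → Vect (Fin (suc a))
    extend w = dot q w ∷ w

    reduce : Vect (Fin (suc a)) → Vect (Fin a)
    reduce r = tail r +v (head r ·v q)

    dot-extend : ∀ r w → dot r (extend w) ≈ dot (reduce r) w
    dot-extend r w = begin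
      head r * dot q w + dot (tail r) w    ≈⟨ +-comm _ _ ⟩
      dot (tail r) w + head r * dot q w    ≈⟨ +-congˡ (sym (dot-·ˡ (head r) q w)) ⟩
      dot (tail r) w + dot (head r ·v q) w ≈⟨ sym (dot-+ˡ (tail r) _ w) ⟩
      dot (reduce r) w                     ∎

    reduce-pivot : reduce p ≈v 0v
    reduce-pivot i = begin
      p (suc i) + head p * - (p₀⁻¹ * p (suc i))    ≈⟨ +-congˡ (sym (-‿distribʳ-* (head p) _)) ⟩
      p (suc i) + - (head p * (p₀⁻¹ * p (suc i)))  ≈⟨ +-congˡ (-‿cong (cancelˡ p₀p₀⁻¹≈1 (p (suc i)))) ⟩
      p (suc i) + - p (suc i)                      ≈⟨ -‿inverseʳ (p (suc i)) ⟩
      0#                                           ∎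

    extend-solves-pivot : ∀ w → dot p (extend w) ≈ 0#
    extend-solves-pivot w = trans (dot-extend p w) (trans (dot-congˡ w reduce-pivot) (dot-zeroˡ w))

    extend-tail : ∀ {c} → dot p c ≈ 0# → extend (tail c) ≈v c
    extend-tail {c} p⊥c zero = head-determined
      (∙-cancelʳ (dot (tail p) (tail c)) _ _ (trans (extend-solves-pivot (tail c)) (sym p⊥c)))
      where
      p₀⁻¹p₀≈1 : p₀⁻¹ * head p ≈ 1#
      p₀⁻¹p₀≈1 = trans (*-comm p₀⁻¹ (head p)) p₀p₀⁻¹≈1
      head-determined : ∀ {x y} → head p * x ≈ head p * y → x ≈ y
      head-determined {x} {y} eq = begin
        x                     ≈⟨ insertˡ p₀⁻¹p₀≈1 x ⟩
        p₀⁻¹ * (head p * x)   ≈⟨ *-congˡ eq ⟩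
        p₀⁻¹ * (head p * y)   ≈⟨ cancelˡ p₀⁻¹p₀≈1 y ⟩
        y                     ∎
    extend-tail p⊥c (suc i) = refl

    extend-isLinear : IsLinear extend
    extend-isLinear = record
      { cong  = λ v≈w → λ { zero → dot-congʳ q v≈w ; (suc i) → v≈w i }
      ; +-hom = λ u v → λ { zero → dot-+ʳ q u v ; (suc i) → refl }
      ; ·-hom = λ a v → λ { zero → dot-·ʳ q a v ; (suc i) → refl }
      }

  HasDim-pivot : ∀ {a r} (rows : Fin (suc r) → Vect (Fin (suc a))) i {p₀⁻¹}
                 (p₀p₀⁻¹≈1 : head (rows i) * p₀⁻¹ ≈ 1#) →
                 ∀ {e} → HasDim (Solutions (Pivot.reduce (rows i) p₀p₀⁻¹≈1 ∘ rows ∘ punchIn i)) e →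
                 HasDim (Solutions rows) e
  HasDim-pivot rows i p₀p₀⁻¹≈1 =
    HasDim-image {S = Solutions reduced} {S' = Solutions rows}
                 extend-isLinear (λ _ extend-w≈0 → extend-w≈0 ∘ suc) maps onto
    where
    open Pivot (rows i) p₀p₀⁻¹≈1
    reduced : Fin _ → Vect (Fin _)
    reduced = reduce ∘ rows ∘ punchIn i
    maps : ∀ {w} → Solutions reduced ∈S w → Solutions rows ∈S extend w
    maps {w} w∈ x with i Fin.≟ x
    ... | yes ≡.refl = extend-solves-pivot w
    ... | no i≢x = ≡.subst (λ x → dot (rows x) (extend w) ≈ 0#) (punchIn-punchOut i≢x)
                     (trans (dot-extend (rows (punchIn i (punchOut i≢x))) w) (w∈ (punchOut i≢x)))
    onto : ∀ {c} → Solutions rows ∈S c → Σ (Vect (Fin _)) λ w → Solutions reduced ∈S w × extend w ≈v c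
    onto {c} c∈ = tail c , reduced⊥ , extend-tail (c∈ i)
      where
      reduced⊥ : Solutions reduced ∈S tail c
      reduced⊥ j = trans (sym (dot-extend (rows (punchIn i j)) (tail c)))
                     (trans (dot-congʳ (rows (punchIn i j)) (extend-tail {c} (c∈ i))) (c∈ (punchIn i j)))

  module _ (_≟_ : Decidable _≈_) where
    solutions-hasDim : ∀ a {r} (rows : Fin r → Vect (Fin a)) →
                       Σ ℕ λ e → HasDim (Solutions rows) e × a ≤ e ℕ.+ r
    solutions-hasDim zero    rows = 0 , ((λ ()) , (λ ()) , (λ _ _ ()) , λ _ _ → (λ ()) , λ ()) , z≤n
    solutions-hasDim (suc a) rows with all? (λ x → head (rows x) ≟ 0#)
    ... | yes heads≈0 =
      let e , dim , bound = solutions-hasDim a (tail ∘ rows)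
      in  suc e
        , HasDim-free-head {S = Solutions (tail ∘ rows)} {S' = Solutions rows}
                           (λ {v} v∈ x → trans (dot-head≈0 (rows x) v (heads≈0 x)) (v∈ x))
                           (λ {v} v∈ x → trans (sym (dot-head≈0 (rows x) v (heads≈0 x))) (v∈ x)) dim
        , s≤s bound
    solutions-hasDim (suc a) {suc r} rows | no ¬heads≈0 =
      let i , p₀≉0       = ¬∀⟶∃¬ _ _ (λ x → head (rows x) ≟ 0#) ¬heads≈0
          p₀⁻¹ , p₀p₀⁻¹≈1 = inverse (head (rows i)) p₀≉0
          e , dim , bound = solutions-hasDim a (Pivot.reduce (rows i) p₀p₀⁻¹≈1 ∘ rows ∘ punchIn i)
      in  e , HasDim-pivot rows i p₀p₀⁻¹≈1 dim
        , ℕₚ.≤-trans (s≤s bound) (ℕₚ.≤-reflexive (≡.sym (ℕₚ.+-suc e r)))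
    solutions-hasDim (suc a) {zero} rows | no ¬heads≈0 = contradiction (λ ()) ¬heads≈0

    nontrivial-solution : ∀ {a r} (rows : Fin r → Vect (Fin a)) → r < a →
                          Σ (Vect (Fin a)) λ w → Solutions rows ∈S w × ¬ (w ≈v 0v)
    nontrivial-solution {a} rows r<a with solutions-hasDim a rows
    ... | zero  , _ , a≤r = contradiction a≤r (ℕₚ.<⇒≱ r<a)
    ... | suc e , (ws , ws∈ , ws-indep , _) , _ =
      ws zero , ws∈ zero , LinIndep⇒head≉0 {vs = ws} ws-indep

  column : ∀ {n m} → Fin m → Mat n m → Vect (Fin n)
  column j M i = M (i , j)

  columns-in-left-span : ∀ {n t s} (M : Mat n (t ℕ.+ s)) → (∀ i l → M (i , t ↑ʳ l) ≈ 0#) →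
                         ∀ j → Σ (Fin t → Carrier) λ c →
                           lincomb t (λ l → column (l ↑ˡ s) M) c ≈v column j M
  columns-in-left-span {t = t} {s} M right≈0 j with splitAt t j in split≡
  ... | inj₁ l = unit l , λ i →
    trans (dot-unitˡ l _) (reflexive (≡.cong (λ j → M (i , j)) (splitAt⁻¹-↑ˡ split≡)))
  ... | inj₂ l = 0v , λ i →
    trans (sumF-zero t (λ _ → zeroˡ _))
          (sym (≡.subst (λ j → M (i , j) ≈ 0#) (splitAt⁻¹-↑ʳ split≡) (right≈0 i l)))

  module MatrixSpace (_≟_ : Decidable _≈_) {n m} (C : Subspace (Fin n × Fin m)) {k'}
                     (C-dim : HasDim C k') where
    private
      B : Fin k' → Mat n m
      B = proj₁ C-dim
      B∈C : ∀ l → C ∈S B l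
      B∈C = proj₁ (proj₂ C-dim)
      B-indep : LinIndep k' B
      B-indep = proj₁ (proj₂ (proj₂ C-dim))
      B-span : ∀ M → C ∈S M → Σ (Fin k' → Carrier) λ c → lincomb k' B c ≈v M
      B-span = proj₂ (proj₂ (proj₂ C-dim))

    restrict⊥-hasDim : ∀ U {d} → HasDim U d → Σ ℕ λ e → HasDim (restrict C (U ⊥)) e
    restrict⊥-hasDim U {d} (us , us∈U , us-basis) =
      let e , dim , _ = solutions-hasDim _≟_ k' (flatten rows)
      in  e , HasDim-image {S = Solutions (flatten rows)} {S' = restrict C (U ⊥)}
                (lincomb-isLinear k' B) B-indep maps onto dim
      where
      rows : Fin d → Fin m → Vect (Fin k')
      rows a j l = dot (us a) (column j (B l))
      dot-column : ∀ a j c → dot (us a) (column j (lincomb k' B c)) ≈ dot (rows a j) c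
      dot-column a j c = trans (dot-lincombʳ (us a) k' (column j ∘ B) c) (dot-comm c (rows a j))
      maps : ∀ {c} → Solutions (flatten rows) ∈S c → restrict C (U ⊥) ∈S lincomb k' B c
      maps {c} c∈ = lincomb∈ C k' c B∈C , λ j →
        Solutions⊆⊥ {U = U} (us∈U , us-basis)
                    (λ a → trans (dot-column a j c) (Solutions-flatten⁻ rows c∈ a j))
      onto : ∀ {M} → restrict C (U ⊥) ∈S M →
             Σ (Vect (Fin k')) λ c → Solutions (flatten rows) ∈S c × lincomb k' B c ≈v M
      onto {M} (M∈C , M⊥) with B-span M M∈C
      ... | c , B·c≈M = c , Solutions-flatten⁺ rows rows⊥c , B·c≈M
        where
        rows⊥c : ∀ a j → dot (rows a j) c ≈ 0#
        rows⊥c a j = begin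
          dot (rows a j) c                        ≈⟨ sym (dot-column a j c) ⟩
          dot (us a) (column j (lincomb k' B c))  ≈⟨ dot-congʳ (us a) (λ i → B·c≈M (i , j)) ⟩
          dot (us a) (column j M)                 ≈⟨ M⊥ j (us a) (us∈U a) ⟩
          0#                                      ∎

    nonzero-vanishing-on-columns : ∀ {s} (cols : Fin s → Fin m) → n ℕ.* s < k' →
                                   Σ (Mat n m) λ M → C ∈S M × ¬ (M ≈v 0v) × (∀ i l → M (i , cols l) ≈ 0#)
    nonzero-vanishing-on-columns cols ns<k' =
      let w , w∈ , w≉0 = nontrivial-solution _≟_ (flatten rows) ns<k'
      in  lincomb k' B w , lincomb∈ C k' w B∈C , w≉0 ∘ B-indep w
        , λ i l → trans (dot-comm w (rows i l)) (Solutions-flatten⁻ rows w∈ i l)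
      where
      rows : Fin n → Fin _ → Vect (Fin k')
      rows i l l′ = B l′ (i , cols l)

    module _ {k} (rep : RepresentsUniform k n m C k') where
      restrict⊥-dim : ∀ U {d} → HasDim U d → k ≤ d →
                      Σ ℕ λ e → HasDim (restrict C (U ⊥)) e × m ℕ.* k ℕ.+ e ≡ k'
      restrict⊥-dim U {d} U-dim k≤d =
        let e , dim = restrict⊥-hasDim U U-dim
        in  e , dim , ≡.subst (λ x → m ℕ.* x ℕ.+ e ≡ k') (ℕₚ.m≤n⇒m⊓n≡m k≤d) (rep U d e U-dim dim)

      dim≡m*k : k ≤ n → k' ≡ m ℕ.* k
      dim≡m*k k≤n =
        let d , U-dim , n≤d+0 = solutions-hasDim _≟_ n (λ ())
            k≤d               = ℕₚ.≤-trans k≤n (≡.subst (n ≤_) (ℕₚ.+-identityʳ d) n≤d+0)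
            e , dim , mk+e≡k' = restrict⊥-dim U U-dim k≤d
            e≡0               = ≈0v⇒dim≡0 (restrict C (U ⊥)) ⊥-trivial dim
        in  ≡.trans (≡.sym mk+e≡k') (≡.trans (≡.cong (m ℕ.* k ℕ.+_) e≡0) (ℕₚ.+-identityʳ _))
        where
        U : Subspace (Fin n)
        U = Solutions {0} (λ ())
        ⊥-trivial : ∀ {M} → restrict C (U ⊥) ∈S M → M ≈v 0v
        ⊥-trivial {M} (_ , M⊥) (i , j) = trans (sym (dot-unitˡ i (column j M))) (M⊥ j (unit i) (λ ()))

      restrict⊥-trivial : k ≤ n → ∀ U {d} → HasDim U d → k ≤ d → ∀ {M} → restrict C (U ⊥) ∈S M → M ≈v 0v
      restrict⊥-trivial k≤n U U-dim k≤d =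
        let e , dim , mk+e≡k' = restrict⊥-dim U U-dim k≤d
            e≡0 = ℕₚ.+-cancelˡ-≡ (m ℕ.* k) e 0
                    (≡.trans mk+e≡k' (≡.trans (dim≡m*k k≤n) (≡.sym (ℕₚ.+-identityʳ _))))
        in  HasDim-0⇒≈0v (restrict C (U ⊥)) (≡.subst (HasDim (restrict C (U ⊥))) e≡0 dim)

      columns-in-small-span⇒≈0 : ∀ {t} → t ℕ.+ k ≤ n → (rs : Fin t → Vect (Fin n)) → ∀ {M} → C ∈S M →
                                 (∀ j → Σ (Fin t → Carrier) λ c → lincomb t rs c ≈v column j M) → M ≈v 0v
      columns-in-small-span⇒≈0 {t} t+k≤n rs {M} M∈C M-cols =
        let d , U-dim , n≤d+t = solutions-hasDim _≟_ n rs
            k≤d = ℕₚ.+-cancelˡ-≤ t k d (ℕₚ.≤-trans t+k≤n (≡.subst (n ≤_) (ℕₚ.+-comm d t) n≤d+t))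
        in  restrict⊥-trivial (ℕₚ.≤-trans (ℕₚ.m≤n+m k t) t+k≤n) (Solutions rs) U-dim k≤d (M∈C , M⊥)
        where
        M⊥ : ∀ j → (Solutions rs ⊥) ∈S column j M
        M⊥ j = let c , rs·c≈col = M-cols j in resp (Solutions rs ⊥) rs·c≈col (lincomb∈Solutions⊥ rs c)

  singleton-bound : Decidable _≈_ → ∀ {k n t s} → t ℕ.+ k ≤ n → UniformRepresentable k n (t ℕ.+ s) →
                    (t ℕ.+ s) ℕ.* k ≤ n ℕ.* s
  singleton-bound _≟_ {k} {n} {t} {s} t+k≤n (C , k' , C-dim , rep) = ℕₚ.≮⇒≥ λ ns<mk →
    let M , M∈C , M≉0 , M-right≈0 =
          nonzero-vanishing-on-columns (t ↑ʳ_) (≡.subst (n ℕ.* s <_) (≡.sym (dim≡m*k rep k≤n)) ns<mk)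
    in  M≉0 (columns-in-small-span⇒≈0 rep t+k≤n _ M∈C (columns-in-left-span M M-right≈0))
    where
    open MatrixSpace _≟_ C C-dim
    k≤n : k ≤ n
    k≤n = ℕₚ.≤-trans (ℕₚ.m≤n+m k t) t+k≤n

open import Data.Nat using (_+_; _*_; _∸_; >-nonZero)
open import Data.Nat.Properties
  using ( ≤-reflexive; ≤-trans; <⇒≤; <⇒≱; ≰⇒>; _≤?_; +-identityʳ; +-monoˡ-≤; +-monoˡ-<; +-cancelˡ-<
        ; *-comm; *-zeroʳ; *-distribʳ-+; *-mono-≤; *-monoʳ-<; m<n⇒0<n∸m; m+[n∸m]≡n; m∸n+n≡m
        ; module ≤-Reasoning )

[t+k]*s<[t+s]*k : ∀ {t k s} → 0 < t → s < k → (t + k) * s < (t + s) * k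
[t+k]*s<[t+s]*k {t} {k} {s} 0<t s<k = begin-strict
  (t + k) * s    ≡⟨ *-distribʳ-+ s t k ⟩
  t * s + k * s  ≡⟨ ≡.cong (t * s +_) (*-comm k s) ⟩
  t * s + s * k  <⟨ +-monoˡ-< (s * k) (*-monoʳ-< t {{>-nonZero 0<t}} s<k) ⟩
  t * k + s * k  ≡⟨ *-distribʳ-+ k t s ⟨
  (t + s) * k    ∎
  where open ≤-Reasoning

column-split : ∀ {k n m} → 0 < k → k < n → 0 < m → m < n →
               Σ ℕ λ t → Σ ℕ λ s → t + s ≡ m × t + k ≤ n × n * s < (t + s) * k
column-split {k} {n} {m} 0<k k<n 0<m m<n with m ≤? n ∸ k
... | yes m≤n∸k = m , 0 , +-identityʳ m , m+k≤n , n*0<[m+0]*k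
  where
  m+k≤n : m + k ≤ n
  m+k≤n = ≤-trans (+-monoˡ-≤ k m≤n∸k) (≤-reflexive (m∸n+n≡m (<⇒≤ k<n)))
  n*0<[m+0]*k : n * 0 < (m + 0) * k
  n*0<[m+0]*k rewrite *-zeroʳ n | +-identityʳ m = *-mono-≤ 0<m 0<k
... | no m≰n∸k = t , s , t+s≡m , ≤-reflexive t+k≡n , ns<[t+s]k
  where
  t s : ℕ
  t = n ∸ k
  s = m ∸ t
  t+s≡m : t + s ≡ m
  t+s≡m = m+[n∸m]≡n (<⇒≤ (≰⇒> m≰n∸k))
  t+k≡n : t + k ≡ n
  t+k≡n = m∸n+n≡m (<⇒≤ k<n)
  s<k : s < k
  s<k = +-cancelˡ-< t s k (≡.subst₂ _<_ (≡.sym t+s≡m) (≡.sym t+k≡n) m<n)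
  ns<[t+s]k : n * s < (t + s) * k
  ns<[t+s]k = ≡.subst (λ x → x * s < (t + s) * k) t+k≡n ([t+k]*s<[t+s]*k (m<n⇒0<n∸m k<n) s<k)

HasCard⇒Decidable : ∀ (F : Field) {q} → HasCard F q → Decidable (Field._≈_ F)
HasCard⇒Decidable F card x y =
  Dec.map′ (λ from-x≡from-y →
              trans (sym (strictlyInverseˡ x)) (trans (to-cong from-x≡from-y) (strictlyInverseˡ y)))
           from-cong (from x Fin.≟ from y)
  where
  open Field F using (trans; sym)
  open Inverse card

-- Finiteness of F is used only to decide equality in F (for pivoting), so q need not be a
-- prime power.
theorem4p1 : ∀ (q : ℕ) → PrimePower q → (F : Field) → HasCard F q →
    ∀ (n k : ℕ) → 2 ≤ n → 0 < k → k < n →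
    ∀ (m : ℕ) → 0 < m → m < n → ¬ LinAlg.UniformRepresentable F k n m
theorem4p1 q _ F card n k _ 0<k k<n m 0<m m<n representable =
  let t , s , t+s≡m , t+k≤n , ns<mk = column-split 0<k k<n 0<m m<n
  in  <⇒≱ ns<mk (singleton-bound F (HasCard⇒Decidable F card) t+k≤n
                   (≡.subst (LinAlg.UniformRepresentable F k n) (≡.sym t+s≡m) representable))
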